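{- Let $G$ be a biconnected graph and let $A\in\mathrm{Part}(G)$ be a part that is a cycle. Then every vertex of $\mathrm{Int}(A)$ has degree $2$ in $G$.
   Context: All graphs are finite, undirected, without loops or multiple edges; $G(U)$ is the subgraph induced on $U$. A connected component means the vertex set of a maximal connected subgraph. A set $R\subset V(G)$ is a cutset if $G-R$ (delete the vertices of $R$) is disconnected; $\mathfrak R_2(G)$ is the set of 2-vertex cutsets. $R$ separates $X$ from $Y$ (where $X,Y\not\subset R$) if no vertex of $X\setminus R$ and no vertex of $Y\setminus R$ lie in a common connected component of $G-R$; $R$ splits $X$ if $X\setminus R$ is not contained in one connected component of $G-R$. $G$ is biconnected if $v(G)>2$ and it has no cutset with at most one vertex. Cutsets $S,T\in\mathfrak R_2(G)$ are independent if neither splits the other; $S$ is single if it is independent with all other cutsets in $\mathfrak R_2(G)$; $\mathfrak O(G)$ is the set of single cutsets. A set $A\subset V(G)$ is a part of $G$ if no cutset of $\mathfrak O(G)$ splits $A$ but every vertex outside $A$ is separated from $A$ by some cutset of $\mathfrak O(G)$; $\mathrm{Part}(G)$ is the set of parts. $\mathrm{Int}(A)$ is the set of vertices of $A$ lying in no single cutset. $G'$ is obtained from $G$ by adding all edges $ab$ with $\{a,b\}\in\mathfrak O(G)$. A part $A$ is a cycle if $G'(A)$ is a simple cycle. -}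

module Defs where

open import Data.Nat using (ℕ; suc; _≤_; _<_; _%_; _+_)
open import Data.Fin using (Fin; toℕ)
open import Data.Fin.Subset using (Subset; _∈_; _∉_; _⊆_; ⁅_⁆; _∪_; ∣_∣)
open import Data.Bool using (Bool; true; false)
open import Data.Vec using (tabulate)
open import Data.Product using (Σ; ∃; ∃-syntax; _×_; _,_)
open import Data.Sum using (_⊎_)
open import Relation.Nullary using (¬_)
open import Relation.Binary.PropositionalEquality using (_≡_; _≢_)
open import Function.Definitions using (Injective)
open import Function.Bundles using (_⇔_)

record Graph : Set where
  field
    n      : ℕ
    adj    : Fin n → Fin n → Bool
    sym    : ∀ i j → adj i j ≡ adj j i
    irrefl : ∀ i → adj i i ≡ false

module _ (G : Graph) where
  open Graph G

  Vtx : Set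
  Vtx = Fin n

  -- Reach R u v : u and v lie in a common connected component of G - R
  -- (a walk from u to v avoiding R).
  data Reach (R : Subset n) (u : Vtx) : Vtx → Set where
    here : u ∉ R → Reach R u u
    step : ∀ {w v} → Reach R u w → adj w v ≡ true → v ∉ R → Reach R u v

  IsCutset : Subset n → Set
  IsCutset R = ∃[ u ] ∃[ v ] (u ∉ R × v ∉ R × ¬ Reach R u v)

  IsCutset2 : Subset n → Set
  IsCutset2 R = ∣ R ∣ ≡ 2 × IsCutset R

  Separates : Subset n → Subset n → Subset n → Set
  Separates R X Y = ¬ (X ⊆ R) × ¬ (Y ⊆ R) ×
    (∀ x y → x ∈ X → x ∉ R → y ∈ Y → y ∉ R → ¬ Reach R x y)

  Splits : Subset n → Subset n → Set
  Splits R X = ∃[ x ] ∃[ y ] (x ∈ X × x ∉ R × y ∈ X × y ∉ R × ¬ Reach R x y)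

  Independent : Subset n → Subset n → Set
  Independent S T = ¬ Splits S T × ¬ Splits T S

  IsSingle : Subset n → Set
  IsSingle S = IsCutset2 S × (∀ T → IsCutset2 T → T ≢ S → Independent S T)

  IsPart : Subset n → Set
  IsPart A = (∀ S → IsSingle S → ¬ Splits S A) ×
             (∀ v → v ∉ A → ∃[ S ] (IsSingle S × Separates S ⁅ v ⁆ A))

  InInt : Subset n → Vtx → Set
  InInt A v = v ∈ A × (∀ S → IsSingle S → v ∉ S)

  Adj' : Vtx → Vtx → Set
  Adj' a b = adj a b ≡ true ⊎ (a ≢ b × IsSingle (⁅ a ⁆ ∪ ⁅ b ⁆))

  -- G'(A) is a simple cycle: A is enumerated without repetition as
  -- f 0, …, f (k-1) with k = m + 3 ≥ 3, and two of these are adjacent in G'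
  -- iff their indices are consecutive modulo k.
  IsCyclePart : Subset n → Set
  IsCyclePart A = Σ ℕ λ m → let k = suc (suc (suc m)) in Σ (Fin k → Vtx) λ f →
    Injective _≡_ _≡_ f ×
    (∀ v → v ∈ A ⇔ (∃[ i ] f i ≡ v)) ×
    (∀ i j → Adj' (f i) (f j) ⇔
      (toℕ j ≡ (toℕ i + 1) % k ⊎ toℕ i ≡ (toℕ j + 1) % k))

  degree : Vtx → ℕ
  degree v = ∣ tabulate (adj v) ∣

  IsBiconnected : Set
  IsBiconnected = 2 < n × (∀ R → ∣ R ∣ ≤ 1 → ¬ IsCutset R)

module Submission where

-- The proof has three ingredients.
--   * Cyclic index arithmetic: on Fin k the relation "j ≡ i + 1 (mod k) or
--     i ≡ j + 1 (mod k)" holds exactly for j = next i and j = prev i, and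
--     next i ≢ prev i as soon as k ≥ 3.
--   * Graph facts: an interior vertex is in no single cutset, so its
--     G'-edges are G-edges; and every G-neighbour u of it lies in A, since a
--     single cutset separating u from A would have to cut the edge uv.
--   * Counting: a Boolean neighbourhood vector whose true entries are
--     exactly two distinct vertices a, b is the subset ⁅ a ⁆ ∪ ⁅ b ⁆, which
--     has two elements.
-- Together: the G-neighbours of f i are exactly f (next i) and f (prev i),
-- which are distinct because f is injective, so deg v = 2.

open import Defs
open import Data.Fin.Subset using (Subset)
open import Relation.Binary.PropositionalEquality using (_≡_)

open import Data.Bool using (Bool; true; false)
open import Data.Empty using (⊥-elim)
open import Data.Fin using (Fin; toℕ; fromℕ; fromℕ<; inject₁)
  renaming (zero to fzero; suc to fsuc)
open import Data.Fin.Properties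
  using (toℕ-injective; toℕ<n; toℕ-fromℕ; toℕ-fromℕ<; toℕ-inject₁)
open import Data.Fin.Subset using (_∈_; ⁅_⁆; _∪_; ∣_∣)
open import Data.Fin.Subset.Properties
  using ( _∈?_; x∈⁅x⁆; x∈⁅y⁆⇒x≡y; x∈⁅y⁆⇔x≡y; x∈p∪q⁺; x∈p∪q⁻
        ; ∣⁅x⁆∣≡1; ∪-identityˡ; ∪-identityʳ)
open import Data.Nat using (ℕ; suc; _+_; _%_; _<_; _≤_; s≤s; s≤s⁻¹; z≤n; NonZero)
open import Data.Nat.DivMod using (m%n<n; m<n⇒m%n≡m; n%n≡0)
open import Data.Nat.Properties
  using (+-comm; suc-injective; m<1+n⇒m<n∨m≡n; <⇒≢; n<1+n; m<n⇒m<1+n)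
open import Data.Product using (∃-syntax; _,_; proj₁)
open import Data.Sum using (_⊎_; inj₁; inj₂; [_,_])
open import Data.Vec using (tabulate; lookup)
open import Data.Vec.Properties using (tabulate-cong; tabulate∘lookup; []=⇒lookup; lookup⇒[]=)
open import Function.Bundles using (_⇔_; mk⇔; Equivalence)
open import Relation.Nullary using (yes; no)
open import Relation.Binary.PropositionalEquality
  using (_≢_; refl; sym; trans; cong; subst; module ≡-Reasoning)

open Equivalence using (to; from)
open ≡-Reasoning

_+1mod_ : ℕ → (k : ℕ) → .{{NonZero k}} → ℕ
x +1mod k = (x + 1) % k

data Position (n : ℕ) : ℕ → Set where
  below : ∀ {x} → x < n → Position n x
  top   : Position n n

position : ∀ {n x} → x < suc n → Position n x
position x<1+n with m<1+n⇒m<n∨m≡n x<1+n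
... | inj₁ x<n  = below x<n
... | inj₂ refl = top

+1mod-below : ∀ {n x} → x < n → x +1mod suc n ≡ suc x
+1mod-below {n} {x} x<n = trans (cong (_% suc n) (+-comm x 1)) (m<n⇒m%n≡m (s≤s x<n))

+1mod-top : ∀ n → n +1mod suc n ≡ 0
+1mod-top n = trans (cong (_% suc n) (+-comm n 1)) (n%n≡0 (suc n))

+1mod-injective : ∀ {n x y} → x < suc n → y < suc n →
                  x +1mod suc n ≡ y +1mod suc n → x ≡ y
+1mod-injective x<k y<k eq with position x<k | position y<k
... | below x<n | below y<n =
  suc-injective (trans (sym (+1mod-below x<n)) (trans eq (+1mod-below y<n)))
+1mod-injective {n} _ _ eq | below x<n | top
  with trans (sym (+1mod-below x<n)) (trans eq (+1mod-top n))
...   | ()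
+1mod-injective {n} _ _ eq | top | below y<n
  with trans (sym (+1mod-top n)) (trans eq (+1mod-below y<n))
...   | ()
+1mod-injective _ _ _ | top | top = refl

+1mod-twice-moves : ∀ {n x} → 2 ≤ n → x < suc n →
                    (x +1mod suc n) +1mod suc n ≢ x
+1mod-twice-moves {n} {x} 2≤n x<k eq with position x<k
... | below x<n with position (s≤s x<n)
...   | below 1+x<n = <⇒≢ (m<n⇒m<1+n (n<1+n x)) (sym (begin
  suc (suc x)                              ≡⟨ sym (+1mod-below 1+x<n) ⟩
  suc x +1mod suc n                        ≡⟨ cong (_+1mod suc n) (sym (+1mod-below x<n)) ⟩
  (x +1mod suc n) +1mod suc n              ≡⟨ eq ⟩
  x                                        ∎))
...   | top = <⇒≢ (s≤s⁻¹ 2≤n) (begin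
  0                                        ≡⟨ sym (+1mod-top n) ⟩
  suc x +1mod suc n                        ≡⟨ cong (_+1mod suc n) (sym (+1mod-below x<n)) ⟩
  (x +1mod suc n) +1mod suc n              ≡⟨ eq ⟩
  x                                        ∎)
+1mod-twice-moves {n} 2≤n _ eq | top = <⇒≢ 2≤n (begin
  1                                        ≡⟨ sym (+1mod-below (s≤s⁻¹ (m<n⇒m<1+n 2≤n))) ⟩
  0 +1mod suc n                            ≡⟨ cong (_+1mod suc n) (sym (+1mod-top n)) ⟩
  (n +1mod suc n) +1mod suc n              ≡⟨ eq ⟩
  n                                        ∎)

CyclicNeighbours : ∀ {n} → Fin (suc n) → Fin (suc n) → Set
CyclicNeighbours {n} i j = toℕ j ≡ toℕ i +1mod suc n ⊎ toℕ i ≡ toℕ j +1mod suc n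

next : ∀ {n} → Fin (suc n) → Fin (suc n)
next {n} i = fromℕ< (m%n<n (toℕ i + 1) (suc n))

prev : ∀ {n} → Fin (suc n) → Fin (suc n)
prev {n} fzero    = fromℕ n
prev     (fsuc i) = inject₁ i

toℕ-next : ∀ {n} (i : Fin (suc n)) → toℕ (next i) ≡ toℕ i +1mod suc n
toℕ-next {n} i = toℕ-fromℕ< (m%n<n (toℕ i + 1) (suc n))

next-prev : ∀ {n} (i : Fin (suc n)) → toℕ (prev i) +1mod suc n ≡ toℕ i
next-prev {n} fzero = trans (cong (_+1mod suc n) (toℕ-fromℕ n)) (+1mod-top n)
next-prev (fsuc i) = trans (cong (_+1mod _) (toℕ-inject₁ i)) (+1mod-below (toℕ<n i))

cyclic-neighbours : ∀ {n} (i j : Fin (suc n)) →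
                    CyclicNeighbours i j ⇔ (j ≡ next i ⊎ j ≡ prev i)
cyclic-neighbours i j = mk⇔ to-neighbour from-neighbour
  where
  to-neighbour : CyclicNeighbours i j → j ≡ next i ⊎ j ≡ prev i
  to-neighbour (inj₁ j≡i+1) = inj₁ (toℕ-injective (trans j≡i+1 (sym (toℕ-next i))))
  to-neighbour (inj₂ i≡j+1) = inj₂ (toℕ-injective
    (+1mod-injective (toℕ<n j) (toℕ<n (prev i)) (trans (sym i≡j+1) (sym (next-prev i)))))
  from-neighbour : j ≡ next i ⊎ j ≡ prev i → CyclicNeighbours i j
  from-neighbour (inj₁ refl) = inj₁ (toℕ-next i)
  from-neighbour (inj₂ refl) = inj₂ (sym (next-prev i))

next≢prev : ∀ {n} → 2 ≤ n → (i : Fin (suc n)) → next i ≢ prev i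
next≢prev {n} 2≤n i next≡prev = +1mod-twice-moves 2≤n (toℕ<n i) (begin
  (toℕ i +1mod suc n) +1mod suc n          ≡⟨ cong (_+1mod suc n) (sym (toℕ-next i)) ⟩
  toℕ (next i) +1mod suc n                 ≡⟨ cong (λ j → toℕ j +1mod suc n) next≡prev ⟩
  toℕ (prev i) +1mod suc n                 ≡⟨ next-prev i ⟩
  toℕ i                                    ∎)

bool-ext : ∀ {b c : Bool} → (b ≡ true ⇔ c ≡ true) → b ≡ c
bool-ext {false} {false} _ = refl
bool-ext {true}  {true}  _ = refl
bool-ext {false} {true}  b⇔c with from b⇔c refl
... | ()
bool-ext {true}  {false} b⇔c with to b⇔c refl
... | ()

tabulate-subset : ∀ {n} (g : Fin n → Bool) (p : Subset n) →
                  (∀ u → g u ≡ true ⇔ u ∈ p) → tabulate g ≡ p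
tabulate-subset g p g⇔p = trans (tabulate-cong pointwise) (tabulate∘lookup p)
  where
  pointwise : ∀ u → g u ≡ lookup p u
  pointwise u = bool-ext (mk⇔ (λ gu → []=⇒lookup (to (g⇔p u) gu))
                              (λ pu → from (g⇔p u) (lookup⇒[]= u p pu)))

∈-pair : ∀ {n} {a b u : Fin n} → u ∈ ⁅ a ⁆ ∪ ⁅ b ⁆ ⇔ (u ≡ a ⊎ u ≡ b)
∈-pair {a = a} {b} = mk⇔
  (λ u∈ab → [ (λ u∈a → inj₁ (to x∈⁅y⁆⇔x≡y u∈a)) , (λ u∈b → inj₂ (to x∈⁅y⁆⇔x≡y u∈b)) ]
               (x∈p∪q⁻ ⁅ a ⁆ ⁅ b ⁆ u∈ab))
  (λ u≡a⊎b → x∈p∪q⁺ ([ (λ u≡a → inj₁ (from x∈⁅y⁆⇔x≡y u≡a))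
                       , (λ u≡b → inj₂ (from x∈⁅y⁆⇔x≡y u≡b)) ] u≡a⊎b))

∣pair∣≡2 : ∀ {n} (a b : Fin n) → a ≢ b → ∣ ⁅ a ⁆ ∪ ⁅ b ⁆ ∣ ≡ 2
∣pair∣≡2 fzero    fzero    a≢b = ⊥-elim (a≢b refl)
∣pair∣≡2 fzero    (fsuc b) _   = cong suc (trans (cong ∣_∣ (∪-identityˡ ⁅ b ⁆)) (∣⁅x⁆∣≡1 b))
∣pair∣≡2 (fsuc a) fzero    _   = cong suc (trans (cong ∣_∣ (∪-identityʳ ⁅ a ⁆)) (∣⁅x⁆∣≡1 a))
∣pair∣≡2 (fsuc a) (fsuc b) a≢b = ∣pair∣≡2 a b (λ a≡b → a≢b (cong fsuc a≡b))

count-two : ∀ {n} (g : Fin n → Bool) (a b : Fin n) → a ≢ b →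
            (∀ u → g u ≡ true ⇔ (u ≡ a ⊎ u ≡ b)) → ∣ tabulate g ∣ ≡ 2
count-two g a b a≢b g⇔ab = begin
  ∣ tabulate g ∣                           ≡⟨ cong ∣_∣ (tabulate-subset g _ g⇔pair) ⟩
  ∣ ⁅ a ⁆ ∪ ⁅ b ⁆ ∣                        ≡⟨ ∣pair∣≡2 a b a≢b ⟩
  2                                        ∎
  where
  g⇔pair : ∀ u → g u ≡ true ⇔ u ∈ ⁅ a ⁆ ∪ ⁅ b ⁆
  g⇔pair u = mk⇔ (λ gu → from ∈-pair (to (g⇔ab u) gu))
                 (λ u∈ab → from (g⇔ab u) (to ∈-pair u∈ab))

module _ (G : Graph) where
  open Graph G using (adj)

  -- The G'-neighbours of an interior vertex are G-neighbours: a G'-only edge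
  -- vw comes from a single cutset {v, w}, which an interior vertex avoids.
  interior-Adj' : ∀ {A v w} → InInt G A v → Adj' G v w → adj v w ≡ true
  interior-Adj' _ (inj₁ vw) = vw
  interior-Adj' {v = v} (_ , v∉single) (inj₂ (_ , single)) =
    ⊥-elim (v∉single _ single (x∈p∪q⁺ (inj₁ (x∈⁅x⁆ v))))

  -- Every G-neighbour of an interior vertex of a part lies in the part: a
  -- single cutset separating it from the part would contain neither end of
  -- the edge, yet the edge is a walk avoiding the cutset.
  interior-neighbour-in-part : ∀ {A v u} → IsPart G A → InInt G A v →
                               adj v u ≡ true → u ∈ A
  interior-neighbour-in-part {A} {v} {u} (_ , separated) (v∈A , v∉single) vu with u ∈? A
  ... | yes u∈A = u∈A
  ... | no u∉A with separated u u∉A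
  ...   | S , single , ⁅u⁆⊈S , _ , separates with u ∈? S
  ...     | yes u∈S = ⊥-elim (⁅u⁆⊈S (λ x∈⁅u⁆ → subst (_∈ S) (sym (x∈⁅y⁆⇒x≡y u x∈⁅u⁆)) u∈S))
  ...     | no u∉S = ⊥-elim (separates u v (x∈⁅x⁆ u) u∉S v∈A v∉S
                               (step (here u∉S) (trans (Graph.sym G u v) vu) v∉S))
    where v∉S = v∉single S single

  interior-cycle-neighbours :
    ∀ {A n} (f : Fin (suc n) → Vtx G) →
    (∀ v → v ∈ A ⇔ (∃[ i ] f i ≡ v)) →
    (∀ i j → Adj' G (f i) (f j) ⇔ CyclicNeighbours i j) →
    IsPart G A → ∀ i → InInt G A (f i) →
    ∀ u → adj (f i) u ≡ true ⇔ (u ≡ f (next i) ⊎ u ≡ f (prev i))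
  interior-cycle-neighbours f enum cycle part i interior u =
    mk⇔ neighbour-on-cycle edge-of-cycle
    where
    neighbour-on-cycle : adj (f i) u ≡ true → u ≡ f (next i) ⊎ u ≡ f (prev i)
    neighbour-on-cycle fi-u with to (enum u) (interior-neighbour-in-part part interior fi-u)
    ... | j , refl with to (cyclic-neighbours i j) (to (cycle i j) (inj₁ fi-u))
    ...   | inj₁ j≡next = inj₁ (cong f j≡next)
    ...   | inj₂ j≡prev = inj₂ (cong f j≡prev)
    edge-of-cycle : u ≡ f (next i) ⊎ u ≡ f (prev i) → adj (f i) u ≡ true
    edge-of-cycle (inj₁ refl) =
      interior-Adj' interior (from (cycle i _) (from (cyclic-neighbours i _) (inj₁ refl)))
    edge-of-cycle (inj₂ refl) =
      interior-Adj' interior (from (cycle i _) (from (cyclic-neighbours i _) (inj₂ refl)))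

corollary2 : (G : Graph) → IsBiconnected G → (A : Subset (Graph.n G)) →
    IsPart G A → IsCyclePart G A →
    ∀ v → InInt G A v → degree G v ≡ 2
corollary2 G _ A part (_ , f , f-injective , enum , cycle) v interior
  with to (enum v) (proj₁ interior)
... | i , refl =
  count-two (Graph.adj G (f i)) (f (next i)) (f (prev i))
    (λ same → next≢prev (s≤s (s≤s z≤n)) i (f-injective same))
    (interior-cycle-neighbours G f enum cycle part i interior)
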